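{- Let $(P, T, h)$ be an acyclic sensor network and let $P_\chi$ be a $\chi$-minimal model of $P$. Let $\widetilde{P}_\chi = \{x \in P_\chi \mid h(x) \ge 1\}$ with the order induced from $P$. Then \[ \int_{\widetilde{P}_\chi} h|_{\widetilde{P}_\chi} \, d\chi = \int_{P} h \, d\chi . \]
   Context: An acyclic sensor network $(P,T,h)$ consists of a finite poset $P$, a finite set $T$ of targets, which are points lying in the Hasse diagram of $P$ viewed as a one-dimensional simplicial complex (on its vertices or edges), and the counting function $h : P \to \mathbb{Z}_{\ge 0}$, where $h(x)$ is the number of targets lying in the part of the Hasse diagram spanned by the prime ideal $P_{\le x} = \{y \in P \mid y \le x\}$ (i.e. the number of targets detected by a sensor at $x$). For a finite poset $P$, the zeta matrix is $\zeta(x,y) = 1$ if $x\le y$ and $0$ otherwise, and the Euler characteristic is $\chi(P) = \sum_{x,y}\zeta^{ -1}(x,y)$ ($\chi(\emptyset)=0$). A point $x$ of $P$ is a $\chi$-point if $\chi(P_{>x}) = 1$, where $P_{>x}=\{y\in P\mid y>x\}$. A $\chi$-minimal model $P_\chi$ of $P$ is a subposet obtained by removing $\chi$-points one at a time (each removed point being a $\chi$-point of the current subposet with induced order) until no $\chi$-points remain. A filter is an upward closed subset; $\delta_S$ is the indicator function of $S$. For a finite poset $R$, every $g : R \to \mathbb{Z}$ can be written as $g = \sum_i a_i\delta_{S_i}$ with $a_i\in\mathbb{Z}$ and $S_i$ filters of $R$, and $\int_R g\,d\chi = \sum_i a_i \chi(S_i)$, independent of the decomposition. -}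

module Defs where

open import Data.Nat using (ℕ; zero; suc)
open import Data.Integer using (ℤ; +_; -_; _+_; _*_)
open import Data.Bool using (Bool; true; false; _∧_; not; if_then_else_; T)
open import Data.Fin using (Fin)
open import Data.Unit using (⊤)
import Data.Fin as Fin
open import Data.List using (List; []; _∷_)
open import Data.List.Relation.Unary.All using (All)
open import Data.List.Relation.Unary.Unique.Propositional using (Unique)
open import Data.Product using (Σ; _×_; _,_; proj₁; proj₂; ∃-syntax)
open import Relation.Nullary using (¬_; Dec; yes; no)
open import Relation.Nullary.Decidable using (⌊_⌋)
open import Relation.Binary.PropositionalEquality using (_≡_)
open import Relation.Binary.Structures using (IsDecPartialOrder)

record FinPoset : Set₁ where
  field
    size  : ℕ
    _≤_   : Fin size → Fin size → Set
    isDecPartialOrder : IsDecPartialOrder _≡_ _≤_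
  open IsDecPartialOrder isDecPartialOrder public using (_≤?_) renaming (_≟_ to _≟ₚ_)

  Elt : Set
  Elt = Fin size

  _<_ : Elt → Elt → Set
  x < y = (x ≤ y) × ¬ (x ≡ y)

  leq : Elt → Elt → Bool
  leq x y = ⌊ x ≤? y ⌋

  lt : Elt → Elt → Bool
  lt x y = leq x y ∧ not ⌊ x Fin.≟ y ⌋

open FinPoset public

-- Subsets of a finite poset (as decidable membership); a subset is
-- regarded as a subposet with the order induced from P.
Subset : FinPoset → Set
Subset P = Elt P → Bool

full : (P : FinPoset) → Subset P
full P _ = true

sumFin : ∀ {n} → (Fin n → ℤ) → ℤ
sumFin {zero}  f = + 0
sumFin {suc n} f = f Fin.zero + sumFin (λ i → f (Fin.suc i))

-- Möbius function (= entries of ζ⁻¹) of the subposet S, computed by the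
-- standard recursion  μ(x,x) = 1,  μ(x,y) = - Σ_{x ≤ z < y, z ∈ S} μ(x,z)
-- for x < y, and μ(x,y) = 0 otherwise.  The fuel argument bounds the
-- length of strict chains; fuel = size P is always sufficient.

möbiusFuel : (P : FinPoset) → Subset P → ℕ → Elt P → Elt P → ℤ
möbiusFuel P S zero    x y = + 0
möbiusFuel P S (suc f) x y with leq P x y | ⌊ x Fin.≟ y ⌋
... | false | _    = + 0
... | true  | true = + 1
... | true  | false =
  - sumFin (λ z → if S z ∧ leq P x z ∧ lt P z y then möbiusFuel P S f x z else + 0)

möbius : (P : FinPoset) → Subset P → Elt P → Elt P → ℤ
möbius P S = möbiusFuel P S (size P)

χ : (P : FinPoset) → Subset P → ℤ
χ P S = sumFin (λ x → sumFin (λ y →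
          if S x ∧ S y then möbius P S x y else + 0))

above : (P : FinPoset) → Subset P → Elt P → Subset P
above P S x y = S y ∧ lt P x y

IsChiPoint : (P : FinPoset) → Subset P → Elt P → Set
IsChiPoint P S x = T (S x) × (χ P (above P S x) ≡ + 1)

remove : (P : FinPoset) → Subset P → Elt P → Subset P
remove P S x y = S y ∧ not ⌊ y Fin.≟ x ⌋

data ChiReduction (P : FinPoset) : Subset P → Subset P → Set where
  done : ∀ {S} → ChiReduction P S S
  step : ∀ {S R} (x : Elt P) → IsChiPoint P S x →
         ChiReduction P (remove P S x) R → ChiReduction P S R

IsChiMinimalModel : (P : FinPoset) → Subset P → Set
IsChiMinimalModel P R =
  ChiReduction P (full P) R × (∀ x → ¬ IsChiPoint P R x)

Covers : (P : FinPoset) → Elt P → Elt P → Set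
Covers P a b = _<_ P a b × (¬ Σ (Elt P) (λ c → _<_ P a c × _<_ P c b))

-- A target is a point of the Hasse diagram: either a vertex, or an
-- interior point of the edge a ⋖ b (the index k distinguishes distinct
-- points lying on the same edge).
data Target (P : FinPoset) : Set where
  vertex : Elt P → Target P
  onEdge : Elt P → Elt P → ℕ → Target P

ValidTarget : (P : FinPoset) → Target P → Set
ValidTarget P (vertex y)     = ⊤
ValidTarget P (onEdge a b k) = Covers P a b

-- target lies in the subcomplex spanned by P_{≤x}
detects : (P : FinPoset) → Elt P → Target P → Bool
detects P x (vertex y)     = leq P y x
detects P x (onEdge a b k) = leq P a x ∧ leq P b x

count : ∀ {A : Set} → (A → Bool) → List A → ℕ
count p []       = 0
count p (a ∷ as) = if p a then suc (count p as) else count p as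

record SensorNetwork : Set₁ where
  field
    poset   : FinPoset
    targets : List (Target poset)
    valid   : All (ValidTarget poset) targets
    distinct : Unique targets

  h : Elt poset → ℕ
  h x = count (detects poset x) targets

open SensorNetwork public

IsFilter : (P : FinPoset) → Subset P → Subset P → Set
IsFilter P R S =
  (∀ x → T (S x) → T (R x)) ×
  (∀ x y → T (R y) → T (S x) → _≤_ P x y → T (S y))

δ : (P : FinPoset) → Subset P → Elt P → ℤ
δ P S x = if S x then + 1 else + 0

evalDecomp : (P : FinPoset) → List (ℤ × Subset P) → Elt P → ℤ
evalDecomp P []              x = + 0
evalDecomp P ((a , S) ∷ ds) x = a * δ P S x + evalDecomp P ds x

IsFilterDecomposition : (P : FinPoset) (R : Subset P) → (Elt P → ℤ) →
                        List (ℤ × Subset P) → Set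
IsFilterDecomposition P R g ds =
  All (λ p → IsFilter P R (proj₂ p)) ds ×
  (∀ x → T (R x) → g x ≡ evalDecomp P ds x)

integralVia : (P : FinPoset) → List (ℤ × Subset P) → ℤ
integralVia P []              = + 0
integralVia P ((a , S) ∷ ds) = a * χ P S + integralVia P ds

tildeModel : (N : SensorNetwork) → Subset (poset N) → Subset (poset N)
tildeModel N R x with h N x
... | zero  = false
... | suc _ = R x

-- The Möbius recursion gives χ(S) = Σ_{a ∈ S} (1 − χ(S_{>a})): the row of ζ⁻¹ at a sums to
-- 1 − χ(S_{>a}), because μ_S(a,b) = − Σ_{c ∈ S_{>a}} μ_{S_{>a}}(c,b) for b > a. The term of a
-- χ-point vanishes, and a χ-point x of S remains one in S_{>a} for a < x and in S ∩ U for an up-set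
-- U ∋ x; hence removing χ-points preserves χ(S ∩ U) for every up-set U. For a filter S of R the
-- formula reads χ(S) = Σ_{a ∈ S} (1 − χ(R_{>a})), so ∫_R g dχ = Σ_{a ∈ R} g(a) (1 − χ(R_{>a}))
-- for every filter decomposition of g. Decomposing h along the targets, ∫_R h dχ = Σ_t χ(R ∩ D_t),
-- where the up-set D_t of sensors detecting t lies in {h ≥ 1}, so P̃_χ ∩ D_t = P_χ ∩ D_t.

module Submission where

open import Defs hiding (_≤_; _<_)

open import Algebra.Bundles using (CommutativeMonoid)
open import Data.Bool using (Bool; true; false; _∧_; not; if_then_else_; T)
open import Data.Bool.Properties
  using (T?; T-∧; T-≡; ∧-commutativeMonoid; ∧-identityʳ; ∧-zeroʳ; if-float; if-swap-then; if-∧; if-cong)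
open import Algebra.Properties.CommutativeSemigroup
  (CommutativeMonoid.commutativeSemigroup ∧-commutativeMonoid) using (xy∙z≈xz∙y)
open import Data.Empty using (⊥-elim)
open import Data.Fin using (Fin; zero; suc; _≟_)
open import Data.Fin.Properties using (suc-injective)
import Data.Fin.Subset as Sub
open import Data.Fin.Subset.Properties using (p⊂q⇒∣p∣<∣q∣; ∣p∣≤n)
open import Data.Integer using (ℤ; +_; -_; _+_; _*_; _-_; -1ℤ)
import Data.Integer.Properties as ℤ
open import Algebra.Properties.Semiring.Sum ℤ.+-*-semiring
  using (sum; sum-cong-≗; sum-replicate-zero; ∑-distrib-+; ∑-comm; *-distribˡ-sum)
open import Data.Integer.Tactic.RingSolver using (solve-∀)
open import Data.List using (List; []; _∷_; map)
open import Data.List.Membership.Propositional using (_∈_)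
open import Data.List.Relation.Unary.All as All using (All; []; _∷_)
open import Data.List.Relation.Unary.Any using (here; there)
import Data.Nat as ℕ
import Data.Nat.Properties as ℕ
open import Data.Product using (_×_; _,_; proj₁; proj₂)
open import Data.Sum using (_⊎_; inj₁; inj₂)
open import Data.Unit using (tt)
open import Data.Vec using (tabulate)
open import Data.Vec.Properties using (lookup∘tabulate; lookup⇒[]=; []=⇒lookup)
open import Function using (_∘_; _⇔_; mk⇔; Equivalence)
open import Relation.Binary.PropositionalEquality
  using (_≡_; _≢_; _≗_; refl; sym; trans; cong; cong₂; module ≡-Reasoning)
open import Relation.Binary.Structures using (IsDecPartialOrder)
open import Relation.Nullary using (¬_; yes; no; contradiction)
open import Relation.Nullary.Decidable
  using (⌊_⌋; toWitness; fromWitness; toWitnessFalse; fromWitnessFalse)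

open Equivalence using (to; from)

sumFin≡sum : ∀ {n} (f : Fin n → ℤ) → sumFin f ≡ sum f
sumFin≡sum {ℕ.zero}  f = refl
sumFin≡sum {ℕ.suc n} f = cong₂ _+_ (refl {x = f zero}) (sumFin≡sum (f ∘ suc))

sumFin-cong : ∀ {n} {f g : Fin n → ℤ} → f ≗ g → sumFin f ≡ sumFin g
sumFin-cong {f = f} {g} f≗g =
  trans (sumFin≡sum f) (trans (sum-cong-≗ f≗g) (sym (sumFin≡sum g)))

sumFin-zero : ∀ n → sumFin {n} (λ _ → + 0) ≡ + 0
sumFin-zero n = trans (sumFin≡sum {n} (λ _ → + 0)) (sum-replicate-zero n)

sumFin-+ : ∀ {n} (f g : Fin n → ℤ) → sumFin (λ i → f i + g i) ≡ sumFin f + sumFin g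
sumFin-+ f g rewrite sumFin≡sum (λ i → f i + g i) | sumFin≡sum f | sumFin≡sum g =
  ∑-distrib-+ f g

sumFin-*ˡ : ∀ {n} c (f : Fin n → ℤ) → c * sumFin f ≡ sumFin (λ i → c * f i)
sumFin-*ˡ c f rewrite sumFin≡sum f | sumFin≡sum (λ i → c * f i) = *-distribˡ-sum c f

sumFin-neg : ∀ {n} (f : Fin n → ℤ) → - sumFin f ≡ sumFin (λ i → - f i)
sumFin-neg f = begin
  - sumFin f                   ≡⟨ ℤ.-1*i≡-i _ ⟨
  -1ℤ * sumFin f               ≡⟨ sumFin-*ˡ -1ℤ f ⟩
  sumFin (λ i → -1ℤ * f i)     ≡⟨ sumFin-cong (ℤ.-1*i≡-i ∘ f) ⟩
  sumFin (λ i → - f i)         ∎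
  where open ≡-Reasoning

sumFin-comm : ∀ {m n} (f : Fin m → Fin n → ℤ) →
              sumFin (λ i → sumFin (f i)) ≡ sumFin (λ j → sumFin (λ i → f i j))
sumFin-comm f = begin
  sumFin (λ i → sumFin (f i))           ≡⟨ sumFin-cong (sumFin≡sum ∘ f) ⟩
  sumFin (λ i → sum (f i))              ≡⟨ sumFin≡sum (λ i → sum (f i)) ⟩
  sum (λ i → sum (f i))                 ≡⟨ ∑-comm f ⟩
  sum (λ j → sum (λ i → f i j))         ≡⟨ sumFin≡sum (λ j → sum (λ i → f i j)) ⟨
  sumFin (λ j → sum (λ i → f i j))      ≡⟨ sumFin-cong (λ j → sumFin≡sum (λ i → f i j)) ⟨
  sumFin (λ j → sumFin (λ i → f i j))   ∎
  where open ≡-Reasoning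

sumFin-single : ∀ {n} (f : Fin n → ℤ) k → (∀ i → i ≢ k → f i ≡ + 0) → sumFin f ≡ f k
sumFin-single {ℕ.suc n} f zero f≡0 = begin
  f zero + sumFin (f ∘ suc)   ≡⟨ cong (λ s → f zero + s) (sumFin-cong (λ i → f≡0 (suc i) λ ())) ⟩
  f zero + sumFin {n} (λ _ → + 0) ≡⟨ cong (λ s → f zero + s) (sumFin-zero n) ⟩
  f zero + + 0                ≡⟨ ℤ.+-identityʳ _ ⟩
  f zero                      ∎
  where open ≡-Reasoning
sumFin-single {ℕ.suc n} f (suc k) f≡0 =
  trans (cong₂ _+_ (f≡0 zero λ ())
                   (sumFin-single (f ∘ suc) k λ i i≢k → f≡0 (suc i) (i≢k ∘ suc-injective)))
        (ℤ.+-identityˡ _)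

sumFin-if : ∀ {n} b (f : Fin n → ℤ) →
            (if b then sumFin f else + 0) ≡ sumFin (λ i → if b then f i else + 0)
sumFin-if true  f = refl
sumFin-if {n} false f = sym (sumFin-zero n)

sumFin-comm-if : ∀ {m n} (p : Fin m → Bool) (q : Fin n → Bool) (f : Fin m → Fin n → ℤ) →
  sumFin (λ j → if q j then sumFin (λ i → if p i then f i j else + 0) else + 0) ≡
  sumFin (λ i → if p i then sumFin (λ j → if q j then f i j else + 0) else + 0)
sumFin-comm-if p q f = begin
  sumFin (λ j → if q j then sumFin (λ i → if p i then f i j else + 0) else + 0)
    ≡⟨ sumFin-cong (λ j → sumFin-if (q j) (λ i → if p i then f i j else + 0)) ⟩
  sumFin (λ j → sumFin (λ i → if q j then (if p i then f i j else + 0) else + 0))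
    ≡⟨ sumFin-comm (λ j i → if q j then (if p i then f i j else + 0) else + 0) ⟩
  sumFin (λ i → sumFin (λ j → if q j then (if p i then f i j else + 0) else + 0))
    ≡⟨ sumFin-cong (λ i → sumFin-cong (λ j → if-swap-then (q j) (p i))) ⟩
  sumFin (λ i → sumFin (λ j → if p i then (if q j then f i j else + 0) else + 0))
    ≡⟨ sumFin-cong (λ i → sumFin-if (p i) (λ j → if q j then f i j else + 0)) ⟨
  sumFin (λ i → if p i then sumFin (λ j → if q j then f i j else + 0) else + 0)
    ∎
  where open ≡-Reasoning

T-injective : ∀ {a b} → T a ⇔ T b → a ≡ b
T-injective {true}  {true}  _   = refl
T-injective {true}  {false} a⇔b = ⊥-elim (to a⇔b tt)
T-injective {false} {true}  a⇔b = ⊥-elim (from a⇔b tt)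
T-injective {false} {false} _   = refl

if-T : ∀ {A : Set} {b} {x y : A} → T b → (if b then x else y) ≡ x
if-T {b = true} _ = refl

if-¬T : ∀ {A : Set} {b} {x y : A} → ¬ T b → (if b then x else y) ≡ y
if-¬T {b = true}  ¬b = ⊥-elim (¬b tt)
if-¬T {b = false} _  = refl

if-cong-T : ∀ {A : Set} {b} {x x′ y : A} → (T b → x ≡ x′) →
            (if b then x else y) ≡ (if b then x′ else y)
if-cong-T {b = true}  x≡x′ = x≡x′ tt
if-cong-T {b = false} _    = refl

∧-cong-T : ∀ {a a′ b} → (T b → a ≡ a′) → a ∧ b ≡ a′ ∧ b
∧-cong-T {a} {a′} {true}  a≡a′ = trans (∧-identityʳ a) (trans (a≡a′ tt) (sym (∧-identityʳ a′)))
∧-cong-T {a} {a′} {false} _    = trans (∧-zeroʳ a) (sym (∧-zeroʳ a′))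

if-zero : ∀ b {x : ℤ} → (T b → x ≡ + 0) → (if b then x else + 0) ≡ + 0
if-zero true  x≡0 = x≡0 tt
if-zero false _   = refl

sumFin-if-zero : ∀ {n} (c : Fin n → Bool) (v : Fin n → ℤ) → (∀ i → T (c i) → v i ≡ + 0) →
                 sumFin (λ i → if c i then v i else + 0) ≡ + 0
sumFin-if-zero {n} c v v≡0 = trans (sumFin-cong (λ i → if-zero (c i) (v≡0 i))) (sumFin-zero n)

if-sub : ∀ b {x y : ℤ} → (if b then x - y else + 0) ≡ (if b then x else + 0) - (if b then y else + 0)
if-sub true  = refl
if-sub false = refl

≡⊎≢ : ∀ {n} (i j : Fin n) → i ≡ j ⊎ i ≢ j
≡⊎≢ i j with i ≟ j
... | yes i≡j = inj₁ i≡j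
... | no i≢j  = inj₂ i≢j

kronecker : ∀ {n} → Fin n → Fin n → ℤ
kronecker i j = if ⌊ i ≟ j ⌋ then + 1 else + 0

kronecker-refl : ∀ {n} (i : Fin n) → kronecker i i ≡ + 1
kronecker-refl i with i ≟ i
... | yes _   = refl
... | no i≢i = contradiction refl i≢i

kronecker-≢ : ∀ {n} {i j : Fin n} → i ≢ j → kronecker i j ≡ + 0
kronecker-≢ {i = i} {j} i≢j with i ≟ j
... | yes i≡j = contradiction i≡j i≢j
... | no _    = refl

sumFin-kronecker : ∀ {n} (p : Fin n → Bool) k → T (p k) →
                   sumFin (λ i → if p i then kronecker i k else + 0) ≡ + 1
sumFin-kronecker p k pk =
  trans (sumFin-single _ k (λ i i≢k → if-zero (p i) (λ _ → kronecker-≢ i≢k)))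
        (trans (if-T pk) (kronecker-refl k))

card : ∀ {n} → (Fin n → Bool) → ℕ.ℕ
card S = Sub.∣ tabulate S ∣

∈-tabulate : ∀ {n} {S : Fin n → Bool} {x} → T (S x) → x Sub.∈ tabulate S
∈-tabulate {S = S} {x} Sx = lookup⇒[]= x (tabulate S) (trans (lookup∘tabulate S x) (to T-≡ Sx))

∈-tabulate⁻ : ∀ {n} {S : Fin n → Bool} {x} → x Sub.∈ tabulate S → T (S x)
∈-tabulate⁻ {S = S} {x} x∈S = from T-≡ (trans (sym (lookup∘tabulate S x)) ([]=⇒lookup x∈S))

card-⊂ : ∀ {n} {R S : Fin n → Bool} → (∀ y → T (R y) → T (S y)) →
         ∀ x → T (S x) → ¬ T (R x) → card R ℕ.< card S
card-⊂ {S = S} R⊆S x Sx ¬Rx = p⊂q⇒∣p∣<∣q∣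
  ( (λ y∈R → ∈-tabulate {S = S} (R⊆S _ (∈-tabulate⁻ y∈R)))
  , x , ∈-tabulate Sx , ¬Rx ∘ ∈-tabulate⁻ )

module EulerCalculus (P : FinPoset) where

  open FinPoset P using (_≤_; _<_)
  open IsDecPartialOrder (isDecPartialOrder P)
    using () renaming (refl to ≤-refl; trans to ≤-trans; antisym to ≤-antisym)

  <-irrefl : ∀ {x} → ¬ x < x
  <-irrefl (_ , x≢x) = x≢x refl

  ≤-<-trans : ∀ {x y z} → x ≤ y → y < z → x < z
  ≤-<-trans x≤y (y≤z , y≢z) = ≤-trans x≤y y≤z , λ { refl → y≢z (≤-antisym y≤z x≤y) }

  <-trans : ∀ {x y z} → x < y → y < z → x < z
  <-trans = ≤-<-trans ∘ proj₁

  ≰⊎≡⊎< : ∀ x y → ¬ x ≤ y ⊎ x ≡ y ⊎ x < y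
  ≰⊎≡⊎< x y with _≤?_ P x y | x ≟ y
  ... | no x≰y  | _        = inj₁ x≰y
  ... | yes _   | yes x≡y  = inj₂ (inj₁ x≡y)
  ... | yes x≤y | no x≢y   = inj₂ (inj₂ (x≤y , x≢y))

  T-leq : ∀ {x y} → T (leq P x y) ⇔ x ≤ y
  T-leq {x} {y} = mk⇔ (toWitness {a? = _≤?_ P x y}) fromWitness

  T-lt : ∀ {x y} → T (lt P x y) ⇔ x < y
  T-lt {x} {y} = mk⇔
    (λ t → let (l , n) = to T-∧ t in to T-leq l , toWitnessFalse {a? = x ≟ y} n)
    (λ (x≤y , x≢y) → from T-∧ (from T-leq x≤y , fromWitnessFalse x≢y))

  _∩_ : Subset P → Subset P → Subset P
  (S ∩ U) y = S y ∧ U y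

  IsUpSet : Subset P → Set
  IsUpSet U = ∀ {y z} → y ≤ z → T (U y) → T (U z)

  subset-ext : ∀ {S R : Subset P} → (∀ y → T (S y) ⇔ T (R y)) → S ≗ R
  subset-ext S⇔R y = T-injective (S⇔R y)

  T-above : ∀ S x y → T (above P S x y) ⇔ (T (S y) × x < y)
  T-above _ _ _ = mk⇔ (λ t → let (s , l) = to T-∧ t in s , to T-lt l)
                      (λ (s , l) → from T-∧ (s , from T-lt l))

  T-remove : ∀ S x y → T (remove P S x y) ⇔ (T (S y) × y ≢ x)
  T-remove _ x y = mk⇔ (λ t → let (s , n) = to T-∧ t in s , toWitnessFalse {a? = y ≟ x} n)
                       (λ (s , n) → from T-∧ (s , fromWitnessFalse n))

  ∧-lt⇒< : ∀ a {z y} → T (a ∧ lt P z y) → z < y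
  ∧-lt⇒< a {z} {y} c = to (T-lt {z} {y}) (proj₂ (to (T-∧ {a}) c))

  above-< : ∀ {S x y} → x < y → above P S x y ≡ S y
  above-< {S} {x} {y} x<y =
    T-injective (mk⇔ (proj₁ ∘ to (T-above S x y)) (λ s → from (T-above S x y) (s , x<y)))

  x∉above : ∀ {S x} → ¬ T (above P S x x)
  x∉above {S} {x} = <-irrefl ∘ proj₂ ∘ to (T-above S x x)

  x∉remove : ∀ {S x} → ¬ T (remove P S x x)
  x∉remove {S} {x} Sx∖x = proj₂ (to (T-remove S x x) Sx∖x) refl

  remove-≢ : ∀ {S x y} → y ≢ x → remove P S x y ≡ S y
  remove-≢ {S} {x} {y} y≢x =
    T-injective (mk⇔ (proj₁ ∘ to (T-remove S x y)) (λ s → from (T-remove S x y) (s , y≢x)))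

  above-remove : ∀ S x a → above P (remove P S x) a ≗ remove P (above P S a) x
  above-remove S x a y = xy∙z≈xz∙y (S y) (not ⌊ y ≟ x ⌋) (lt P a y)

  remove-∩ : ∀ S U x → remove P (S ∩ U) x ≗ remove P S x ∩ U
  remove-∩ S U x y = xy∙z≈xz∙y (S y) (U y) (not ⌊ y ≟ x ⌋)

  above-remove-≮ : ∀ {S x a} → ¬ a < x → above P (remove P S x) a ≗ above P S a
  above-remove-≮ {S} {x} {a} a≮x = subset-ext λ y → mk⇔
    (λ t → let (s∖x , a<y) = to (T-above (remove P S x) a y) t in
           from (T-above S a y) (proj₁ (to (T-remove S x y) s∖x) , a<y))
    (λ t → let (s , a<y) = to (T-above S a y) t in
           from (T-above (remove P S x) a y) (from (T-remove S x y) (s , λ { refl → a≮x a<y }) , a<y))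

  above-above : ∀ {S a x} → a < x → above P (above P S a) x ≗ above P S x
  above-above {S} {a} {x} a<x = subset-ext λ y → mk⇔
    (λ t → let (s , x<y) = to (T-above (above P S a) x y) t in
           from (T-above S x y) (proj₁ (to (T-above S a y) s) , x<y))
    (λ t → let (s , x<y) = to (T-above S x y) t in
           from (T-above (above P S a) x y) (from (T-above S a y) (s , <-trans a<x x<y) , x<y))

  above-∩-upset : ∀ {S U x} → IsUpSet U → T (U x) → above P (S ∩ U) x ≗ above P S x
  above-∩-upset {S} {U} {x} up Ux = subset-ext λ y → mk⇔
    (λ t → let (su , x<y) = to (T-above (S ∩ U) x y) t in
           from (T-above S x y) (proj₁ (to T-∧ su) , x<y))
    (λ t → let (s , x<y) = to (T-above S x y) t in
           from (T-above (S ∩ U) x y) (from T-∧ (s , up (proj₁ x<y) Ux) , x<y))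

  ∩-remove-∉ : ∀ {S U x} → ¬ T (U x) → S ∩ U ≗ remove P S x ∩ U
  ∩-remove-∉ {S} {U} {x} ¬Ux = subset-ext λ y → mk⇔
    (λ t → let (s , u) = to T-∧ t in
           from T-∧ (from (T-remove S x y) (s , λ { refl → ¬Ux u }) , u))
    (λ t → let (s∖x , u) = to T-∧ t in from T-∧ (proj₁ (to (T-remove S x y) s∖x) , u))

  depth : Elt P → ℕ.ℕ
  depth y = card (λ z → lt P z y)

  depth-< : ∀ {z y} → z < y → depth z ℕ.< depth y
  depth-< {z} {y} z<y = card-⊂ {R = λ w → lt P w z} {S = λ w → lt P w y}
    (λ w w<z → from T-lt (<-trans (to T-lt w<z) z<y)) z (from T-lt z<y) (<-irrefl ∘ to T-lt)

  depth<size : ∀ y → depth y ℕ.< size P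
  depth<size y = ℕ.<-≤-trans
    (card-⊂ {R = λ w → lt P w y} {S = full P} (λ _ _ → tt) y tt (<-irrefl ∘ to T-lt))
    (∣p∣≤n (tabulate (full P)))

  -- The Möbius function

  μ : Subset P → Elt P → Elt P → ℤ
  μ = möbius P

  μ-column : Subset P → Elt P → ℤ
  μ-column S b = sumFin (λ c → if S c then μ S c b else + 0)

  module _ (S : Subset P) where

    möbiusFuel-≰ : ∀ f {x y} → ¬ x ≤ y → möbiusFuel P S f x y ≡ + 0
    möbiusFuel-≰ ℕ.zero    _   = refl
    möbiusFuel-≰ (ℕ.suc f) {x} {y} x≰y with _≤?_ P x y
    ... | yes x≤y = contradiction x≤y x≰y
    ... | no _    = refl

    möbiusFuel-refl : ∀ f x → möbiusFuel P S (ℕ.suc f) x x ≡ + 1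
    möbiusFuel-refl f x with _≤?_ P x x | x ≟ x
    ... | yes _  | yes _  = refl
    ... | yes _  | no x≢x = contradiction refl x≢x
    ... | no x≰x | _      = contradiction ≤-refl x≰x

    möbiusFuel-< : ∀ f {x y} → x < y → möbiusFuel P S (ℕ.suc f) x y ≡
      - sumFin (λ z → if S z ∧ leq P x z ∧ lt P z y then möbiusFuel P S f x z else + 0)
    möbiusFuel-< f {x} {y} (x≤y , x≢y) with _≤?_ P x y | x ≟ y
    ... | yes _  | no _    = refl
    ... | yes _  | yes x≡y = contradiction x≡y x≢y
    ... | no x≰y | _       = contradiction x≤y x≰y

    strictly-below : ∀ {x y z} → T (S z ∧ leq P x z ∧ lt P z y) → z < y
    strictly-below {x} {z = z} c = ∧-lt⇒< (leq P x z) (proj₂ (to (T-∧ {S z}) c))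

    möbiusFuel-stable : ∀ {f g} x y → depth y ℕ.< f → depth y ℕ.< g →
                        möbiusFuel P S f x y ≡ möbiusFuel P S g x y
    möbiusFuel-stable {ℕ.suc f} {ℕ.suc g} x y (ℕ.s≤s df) (ℕ.s≤s dg) with ≰⊎≡⊎< x y
    ... | inj₁ x≰y         = trans (möbiusFuel-≰ (ℕ.suc f) x≰y) (sym (möbiusFuel-≰ (ℕ.suc g) x≰y))
    ... | inj₂ (inj₁ refl) = trans (möbiusFuel-refl f x) (sym (möbiusFuel-refl g x))
    ... | inj₂ (inj₂ x<y)  =
      trans (möbiusFuel-< f x<y)
     (trans (cong -_ (sumFin-cong λ z → if-cong-T λ c →
              let dz<dy = depth-< (strictly-below c) in
              möbiusFuel-stable x z (ℕ.<-≤-trans dz<dy df) (ℕ.<-≤-trans dz<dy dg)))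
            (sym (möbiusFuel-< g x<y)))

    μ-fuel : ∀ x y → μ S x y ≡ möbiusFuel P S (ℕ.suc (depth y)) x y
    μ-fuel x y = möbiusFuel-stable x y (depth<size y) (ℕ.n<1+n _)

    μ-≰ : ∀ {x y} → ¬ x ≤ y → μ S x y ≡ + 0
    μ-≰ = möbiusFuel-≰ (size P)

    μ-refl : ∀ x → μ S x x ≡ + 1
    μ-refl x = trans (μ-fuel x x) (möbiusFuel-refl _ x)

    μ-< : ∀ {x y} → x < y →
          μ S x y ≡ - sumFin (λ z → if S z ∧ leq P x z ∧ lt P z y then μ S x z else + 0)
    μ-< {x} {y} x<y =
      trans (μ-fuel x y)
     (trans (möbiusFuel-< _ x<y)
            (cong -_ (sumFin-cong λ z → if-cong-T λ c →
              sym (möbiusFuel-stable x z (depth<size z) (depth-< (strictly-below c))))))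

    möbius-recursion : ∀ x y →
      sumFin (λ z → if S z ∧ lt P z y then μ S x z else + 0) ≡ kronecker x y - μ S x y
    möbius-recursion x y with ≰⊎≡⊎< x y
    ... | inj₁ x≰y =
      trans (sumFin-if-zero (λ z → S z ∧ lt P z y) (μ S x)
                            λ z c → μ-≰ λ x≤z → x≰y (≤-trans x≤z (proj₁ (∧-lt⇒< (S z) c))))
            (sym (cong₂ _-_ (kronecker-≢ {i = x} {y} λ { refl → x≰y ≤-refl }) (μ-≰ x≰y)))
    ... | inj₂ (inj₁ refl) =
      trans (sumFin-if-zero (λ z → S z ∧ lt P z x) (μ S x)
                            λ z c → μ-≰ λ x≤z → <-irrefl (≤-<-trans x≤z (∧-lt⇒< (S z) c)))
            (sym (cong₂ _-_ (kronecker-refl x) (μ-refl x)))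
    ... | inj₂ (inj₂ x<y) = begin
      sumFin (λ z → if S z ∧ lt P z y then μ S x z else + 0)
        ≡⟨ sumFin-cong relevant-terms ⟩
      sumFin (λ z → if S z ∧ leq P x z ∧ lt P z y then μ S x z else + 0)
        ≡⟨ ℤ.neg-involutive _ ⟨
      - - sumFin (λ z → if S z ∧ leq P x z ∧ lt P z y then μ S x z else + 0)
        ≡⟨ cong -_ (μ-< x<y) ⟨
      - μ S x y
        ≡⟨ ℤ.+-identityˡ _ ⟨
      + 0 - μ S x y
        ≡⟨ cong (_- μ S x y) (kronecker-≢ (proj₂ x<y)) ⟨
      kronecker x y - μ S x y
        ∎
      where
      open ≡-Reasoning
      relevant-terms : ∀ z → (if S z ∧ lt P z y then μ S x z else + 0) ≡
                             (if S z ∧ leq P x z ∧ lt P z y then μ S x z else + 0)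
      relevant-terms z with _≤?_ P x z
      ... | yes _   = refl
      ... | no x≰z  = trans (if-zero (S z ∧ lt P z y) λ _ → μ-≰ x≰z)
                            (sym (if-zero (S z ∧ false ∧ lt P z y) λ _ → μ-≰ x≰z))

    μ-split-bottom : ∀ {x} (q : Subset P) → T (S x) → T (q x) →
      sumFin (λ z → if S z ∧ q z then μ S x z else + 0) ≡
      + 1 + sumFin (λ z → if above P S x z ∧ q z then μ S x z else + 0)
    μ-split-bottom {x} q Sx qx = begin
      sumFin (λ z → if S z ∧ q z then μ S x z else + 0)
        ≡⟨ sumFin-cong split ⟩
      sumFin (λ z → kronecker z x + (if above P S x z ∧ q z then μ S x z else + 0))
        ≡⟨ sumFin-+ (λ z → kronecker z x) _ ⟩
      sumFin (λ z → kronecker z x) + sumFin (λ z → if above P S x z ∧ q z then μ S x z else + 0)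
        ≡⟨ cong (λ t → t + sumFin (λ z → if above P S x z ∧ q z then μ S x z else + 0))
                (sumFin-kronecker (full P) x tt) ⟩
      + 1 + sumFin (λ z → if above P S x z ∧ q z then μ S x z else + 0)
        ∎
      where
      open ≡-Reasoning
      split : ∀ z → (if S z ∧ q z then μ S x z else + 0) ≡
                    kronecker z x + (if above P S x z ∧ q z then μ S x z else + 0)
      split z with ≰⊎≡⊎< x z
      ... | inj₁ x≰z = trans (if-zero (S z ∧ q z) λ _ → μ-≰ x≰z)
        (sym (cong₂ _+_ (kronecker-≢ {i = z} λ { refl → x≰z ≤-refl })
                        (if-zero (above P S x z ∧ q z) λ _ → μ-≰ x≰z)))
      ... | inj₂ (inj₁ refl) = trans (if-T (from T-∧ (Sx , qx))) (trans (μ-refl x)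
        (sym (cong₂ _+_ (kronecker-refl x)
                        (if-¬T {b = above P S x x ∧ q x} (x∉above {S} {x} ∘ proj₁ ∘ to T-∧)))))
      ... | inj₂ (inj₂ x<z) = trans (if-cong (cong (_∧ q z) (sym (above-< {S} x<z))))
        (sym (trans (cong (λ t → t + (if above P S x z ∧ q z then μ S x z else + 0))
                          (kronecker-≢ (proj₂ x<z ∘ sym)))
                    (ℤ.+-identityˡ _)))

    ∑-μ-strictly-below : ∀ {b} → T (S b) →
      sumFin (λ c → if S c then sumFin (λ z → if S z ∧ lt P z b then μ S c z else + 0) else + 0)
        ≡ + 1 - μ-column S b
    ∑-μ-strictly-below {b} Sb = begin
      sumFin (λ c → if S c then sumFin (λ z → if S z ∧ lt P z b then μ S c z else + 0) else + 0)
        ≡⟨ sumFin-cong (λ c → cong (λ t → if S c then t else + 0) (möbius-recursion c b)) ⟩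
      sumFin (λ c → if S c then kronecker c b - μ S c b else + 0)
        ≡⟨ sumFin-cong (λ c → if-sub (S c)) ⟩
      sumFin (λ c → (if S c then kronecker c b else + 0) - (if S c then μ S c b else + 0))
        ≡⟨ sumFin-+ (λ c → if S c then kronecker c b else + 0) (λ c → - (if S c then μ S c b else + 0)) ⟩
      sumFin (λ c → if S c then kronecker c b else + 0) + sumFin (λ c → - (if S c then μ S c b else + 0))
        ≡⟨ cong₂ _+_ (sumFin-kronecker S b Sb) (sym (sumFin-neg (λ c → if S c then μ S c b else + 0))) ⟩
      + 1 - μ-column S b
        ∎
      where open ≡-Reasoning

  möbiusFuel-cong : ∀ {S R} → S ≗ R → ∀ f x y → möbiusFuel P S f x y ≡ möbiusFuel P R f x y
  möbiusFuel-cong S≗R ℕ.zero    x y = refl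
  möbiusFuel-cong S≗R (ℕ.suc f) x y with leq P x y | ⌊ x ≟ y ⌋
  ... | false | _     = refl
  ... | true  | true  = refl
  ... | true  | false = cong -_ (sumFin-cong λ z →
    cong₂ (λ s m → if s ∧ leq P x z ∧ lt P z y then m else + 0) (S≗R z) (möbiusFuel-cong S≗R f x z))

  χ-cong : ∀ {S R} → S ≗ R → χ P S ≡ χ P R
  χ-cong S≗R = sumFin-cong λ x → sumFin-cong λ y →
    cong₂ (λ s m → if s then m else + 0) (cong₂ _∧_ (S≗R x) (S≗R y)) (möbiusFuel-cong S≗R (size P) x y)

  -- The Euler characteristic and χ-points

  χ-rows : ∀ S → χ P S ≡ sumFin (λ a → if S a then sumFin (λ b → if S b then μ S a b else + 0) else + 0)
  χ-rows S = sumFin-cong λ a →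
    trans (sumFin-cong λ b → if-∧ (S a) {S b} {μ S a b} {+ 0})
          (sym (sumFin-if (S a) (λ b → if S b then μ S a b else + 0)))

  μ-above : ∀ S {x b} → T (S x) → T (above P S x b) → μ S x b ≡ - μ-column (above P S x) b
  μ-above S {x} {b} Sx = μ-above-below (ℕ.suc (depth b)) (ℕ.n<1+n _)
    where
    U = above P S x

    solve-for-μ : ∀ m a s → + 1 + s ≡ + 0 - m → s ≡ - (+ 1 - a) → m ≡ - a
    solve-for-μ m a s e₁ e₂ = begin
      m                     ≡⟨ negate-twice m ⟩
      - (+ 0 - m)           ≡⟨ cong -_ e₁ ⟨
      - (+ 1 + s)           ≡⟨ cong (λ t → - (+ 1 + t)) e₂ ⟩
      - (+ 1 + - (+ 1 - a)) ≡⟨ cancel-one a ⟩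
      - a                   ∎
      where
      open ≡-Reasoning
      negate-twice : ∀ m → m ≡ - (+ 0 - m)
      negate-twice = solve-∀
      cancel-one : ∀ a → - (+ 1 + - (+ 1 - a)) ≡ - a
      cancel-one = solve-∀

    μ-above-below : ∀ n {b} → depth b ℕ.< n → T (U b) → μ S x b ≡ - μ-column U b
    μ-above-below (ℕ.suc n) {b} (ℕ.s≤s db<n) Ub =
      solve-for-μ (μ S x b) (μ-column U b) below-b recursion-at-b below-b-by-columns
      where
      x<b = proj₂ (to (T-above S x b) Ub)
      below : Elt P → Bool
      below z = U z ∧ lt P z b
      below-b = sumFin (λ z → if below z then μ S x z else + 0)

      recursion-at-b : + 1 + below-b ≡ + 0 - μ S x b
      recursion-at-b = begin
        + 1 + below-b
          ≡⟨ μ-split-bottom S (λ z → lt P z b) Sx (from T-lt x<b) ⟨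
        sumFin (λ z → if S z ∧ lt P z b then μ S x z else + 0)
          ≡⟨ möbius-recursion S x b ⟩
        kronecker x b - μ S x b
          ≡⟨ cong (_- μ S x b) (kronecker-≢ (proj₂ x<b)) ⟩
        + 0 - μ S x b
          ∎
        where open ≡-Reasoning

      below-b-by-columns : below-b ≡ - (+ 1 - μ-column U b)
      below-b-by-columns = begin
        below-b
          ≡⟨ sumFin-cong (λ z → if-cong-T {b = below z} λ c →
               μ-above-below n (ℕ.<-≤-trans (depth-< (∧-lt⇒< (U z) c)) db<n) (proj₁ (to T-∧ c))) ⟩
        sumFin (λ z → if below z then - μ-column U z else + 0)
          ≡⟨ sumFin-cong (λ z → if-float -_ (below z)) ⟨
        sumFin (λ z → - (if below z then μ-column U z else + 0))
          ≡⟨ sumFin-neg (λ z → if below z then μ-column U z else + 0) ⟨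
        - sumFin (λ z → if below z then μ-column U z else + 0)
          ≡⟨ cong -_ (sumFin-comm-if U below (μ U)) ⟩
        - sumFin (λ c → if U c then sumFin (λ z → if below z then μ U c z else + 0) else + 0)
          ≡⟨ cong -_ (∑-μ-strictly-below U Ub) ⟩
        - (+ 1 - μ-column U b)
          ∎
        where open ≡-Reasoning

  χ-weight : Subset P → Elt P → ℤ
  χ-weight S x = + 1 - χ P (above P S x)

  μ-row : ∀ S {x} → T (S x) → sumFin (λ b → if S b then μ S x b else + 0) ≡ χ-weight S x
  μ-row S {x} Sx = begin
    sumFin (λ b → if S b then μ S x b else + 0)
      ≡⟨ sumFin-cong (λ b → if-cong (sym (∧-identityʳ (S b)))) ⟩
    sumFin (λ b → if S b ∧ true then μ S x b else + 0)
      ≡⟨ μ-split-bottom S (full P) Sx tt ⟩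
    + 1 + sumFin (λ b → if U b ∧ true then μ S x b else + 0)
      ≡⟨ cong (λ t → + 1 + t) (sumFin-cong λ b →
           trans (if-cong (∧-identityʳ (U b))) (if-cong-T {b = U b} (μ-above S Sx))) ⟩
    + 1 + sumFin (λ b → if U b then - μ-column U b else + 0)
      ≡⟨ cong (λ t → + 1 + t) (sumFin-cong λ b → if-float -_ (U b)) ⟨
    + 1 + sumFin (λ b → - (if U b then μ-column U b else + 0))
      ≡⟨ cong (λ t → + 1 + t) (sumFin-neg (λ b → if U b then μ-column U b else + 0)) ⟨
    + 1 - sumFin (λ b → if U b then μ-column U b else + 0)
      ≡⟨ cong (λ t → + 1 - t) (trans (sumFin-comm-if U U (μ U)) (sym (χ-rows U))) ⟩
    χ-weight S x
      ∎
    where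
    open ≡-Reasoning
    U = above P S x

  χ-local : ∀ S → χ P S ≡ sumFin (λ a → if S a then χ-weight S a else + 0)
  χ-local S = trans (χ-rows S) (sumFin-cong λ a → if-cong-T {b = S a} (μ-row S))

  χ-remove : ∀ {S x} → IsChiPoint P S x → χ P (remove P S x) ≡ χ P S
  χ-remove {S} = χ-remove-bounded (ℕ.suc (card S)) (ℕ.n<1+n _)
    where
    χ-remove-bounded : ∀ n {S x} → card S ℕ.< n → IsChiPoint P S x → χ P (remove P S x) ≡ χ P S
    χ-remove-bounded (ℕ.suc n) {S} {x} (ℕ.s≤s |S|≤n) (Sx , χ₁) = begin
      χ P (remove P S x)
        ≡⟨ χ-local (remove P S x) ⟩
      sumFin (λ a → if remove P S x a then χ-weight (remove P S x) a else + 0)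
        ≡⟨ sumFin-cong same-weights ⟩
      sumFin (λ a → if S a then χ-weight S a else + 0)
        ≡⟨ χ-local S ⟨
      χ P S
        ∎
      where
      open ≡-Reasoning
      χ-above-remove : ∀ a → T (S a) → χ P (above P (remove P S x) a) ≡ χ P (above P S a)
      χ-above-remove a Sa with T? (lt P a x)
      ... | no a≮x  = χ-cong (above-remove-≮ {S} (a≮x ∘ from T-lt))
      ... | yes a<x = trans (χ-cong (above-remove S x a))
        (χ-remove-bounded n {above P S a}
          (ℕ.<-≤-trans (card-⊂ {R = above P S a} {S = S} (λ y → proj₁ ∘ to (T-above S a y))
                                a Sa (x∉above {S} {a}))
                       |S|≤n)
          (from (T-above S a x) (Sx , to T-lt a<x) , trans (χ-cong (above-above {S} (to T-lt a<x))) χ₁))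

      same-weights : ∀ a → (if remove P S x a then χ-weight (remove P S x) a else + 0) ≡
                           (if S a then χ-weight S a else + 0)
      same-weights a with ≡⊎≢ a x
      ... | inj₁ refl = trans (if-¬T (x∉remove {S})) (sym (trans (if-T Sx) (cong (λ t → + 1 - t) χ₁)))
      ... | inj₂ a≢x  = trans (if-cong (remove-≢ {S} a≢x))
        (if-cong-T {b = S a} λ Sa → cong (λ t → + 1 - t) (χ-above-remove a Sa))

  χ-∩-reduction : ∀ {S R U} → ChiReduction P S R → IsUpSet U → χ P (S ∩ U) ≡ χ P (R ∩ U)
  χ-∩-reduction done _ = refl
  χ-∩-reduction {S} {U = U} (step x (Sx , χ₁) reduction) up =
    trans χ-∩-step (χ-∩-reduction reduction up)
    where
    χ-∩-step : χ P (S ∩ U) ≡ χ P (remove P S x ∩ U)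
    χ-∩-step with T? (U x)
    ... | no ¬Ux = χ-cong (∩-remove-∉ {S} ¬Ux)
    ... | yes Ux = trans (sym (χ-remove (from T-∧ (Sx , Ux) , trans (χ-cong (above-∩-upset {S} up Ux)) χ₁)))
                         (χ-cong (remove-∩ S U x))

  -- Euler integration and sensor networks

  filter-above : ∀ {R S a} → IsFilter P R S → T (S a) → above P S a ≗ above P R a
  filter-above {R} {S} {a} (S⊆R , upward) Sa = subset-ext λ y → mk⇔
    (λ t → let (s , a<y) = to (T-above S a y) t in from (T-above R a y) (S⊆R y s , a<y))
    (λ t → let (r , a<y) = to (T-above R a y) t in from (T-above S a y) (upward a y r Sa (proj₁ a<y) , a<y))

  χ-filter : ∀ {R S} → IsFilter P R S → χ P S ≡ sumFin (λ a → if S a then χ-weight R a else + 0)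
  χ-filter {R} {S} isFilter = trans (χ-local S) (sumFin-cong λ a → if-cong-T {b = S a} λ Sa →
    cong (λ t → + 1 - t) (χ-cong (filter-above {R} isFilter Sa)))

  integralVia-filters : ∀ {R} ds → All (IsFilter P R ∘ proj₂) ds →
    integralVia P ds ≡ sumFin (λ a → if R a then evalDecomp P ds a * χ-weight R a else + 0)
  integralVia-filters {R} [] [] =
    sym (sumFin-if-zero R (λ a → + 0 * χ-weight R a) λ a _ → ℤ.*-zeroˡ (χ-weight R a))
  integralVia-filters {R} ((c , S) ∷ ds) (isFilter ∷ filters) = begin
    c * χ P S + integralVia P ds
      ≡⟨ cong₂ _+_ (cong (c *_) (χ-filter isFilter)) (integralVia-filters ds filters) ⟩
    c * sumFin (λ a → if S a then w a else + 0) + sumFin (λ a → if R a then e a * w a else + 0)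
      ≡⟨ cong (λ t → t + sumFin (λ a → if R a then e a * w a else + 0))
              (sumFin-*ˡ c (λ a → if S a then w a else + 0)) ⟩
    sumFin (λ a → c * (if S a then w a else + 0)) + sumFin (λ a → if R a then e a * w a else + 0)
      ≡⟨ sumFin-+ (λ a → c * (if S a then w a else + 0)) (λ a → if R a then e a * w a else + 0) ⟨
    sumFin (λ a → c * (if S a then w a else + 0) + (if R a then e a * w a else + 0))
      ≡⟨ sumFin-cong combine ⟩
    sumFin (λ a → if R a then (c * δ P S a + e a) * w a else + 0)
      ∎
    where
    open ≡-Reasoning
    w = χ-weight R
    e = evalDecomp P ds
    distrib : ∀ b c e w → c * (if b then w else + 0) + e * w ≡ (c * (if b then + 1 else + 0) + e) * w
    distrib true  = member
      where member : ∀ c e w → c * w + e * w ≡ (c * + 1 + e) * w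
            member = solve-∀
    distrib false = nonmember
      where nonmember : ∀ c e w → c * + 0 + e * w ≡ (c * + 0 + e) * w
            nonmember = solve-∀
    combine : ∀ a → c * (if S a then w a else + 0) + (if R a then e a * w a else + 0) ≡
                    (if R a then (c * δ P S a + e a) * w a else + 0)
    combine a with T? (R a)
    ... | yes Ra = trans (cong (λ t → c * (if S a then w a else + 0) + t) (if-T Ra))
                         (trans (distrib (S a) c (e a) (w a)) (sym (if-T Ra)))
    ... | no ¬Ra = trans (cong₂ (λ s r → c * s + r) (if-¬T (¬Ra ∘ proj₁ isFilter a)) (if-¬T ¬Ra))
                         (trans (ℤ.+-identityʳ _) (trans (ℤ.*-zeroʳ c) (sym (if-¬T ¬Ra))))

  integralVia-decomposition : ∀ {R g ds} → IsFilterDecomposition P R g ds →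
    integralVia P ds ≡ sumFin (λ a → if R a then g a * χ-weight R a else + 0)
  integralVia-decomposition {R} {ds = ds} (filters , g≡ds) =
    trans (integralVia-filters ds filters) (sumFin-cong λ a → if-cong-T {b = R a} λ Ra →
      cong (_* χ-weight R a) (sym (g≡ds a Ra)))

  integralVia-independent : ∀ {R g ds es} → IsFilterDecomposition P R g ds →
    IsFilterDecomposition P R g es → integralVia P ds ≡ integralVia P es
  integralVia-independent D E = trans (integralVia-decomposition D) (sym (integralVia-decomposition E))

  detectors : Target P → Subset P
  detectors t y = detects P y t

  detects-upward : ∀ t → IsUpSet (detectors t)
  detects-upward (vertex v)     y≤z d = from T-leq (≤-trans (to T-leq d) y≤z)
  detects-upward (onEdge a b _) y≤z d = let (a≤y , b≤y) = to T-∧ d in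
    from T-∧ (from T-leq (≤-trans (to T-leq a≤y) y≤z) , from T-leq (≤-trans (to T-leq b≤y) y≤z))

  ∩-upset-isFilter : ∀ {R U} → IsUpSet U → IsFilter P R (R ∩ U)
  ∩-upset-isFilter up = (λ _ → proj₁ ∘ to T-∧) ,
                        λ x y Ry RUx x≤y → from T-∧ (Ry , up x≤y (proj₂ (to T-∧ RUx)))

  targetDecomposition : Subset P → List (Target P) → List (ℤ × Subset P)
  targetDecomposition R = map (λ t → + 1 , R ∩ detectors t)

  targetDecomposition-isFilterDecomposition : ∀ R ts →
    IsFilterDecomposition P R (λ y → + count (detects P y) ts) (targetDecomposition R ts)
  targetDecomposition-isFilterDecomposition R ts = filters ts , evaluates ts
    where
    filters : ∀ ts → All (IsFilter P R ∘ proj₂) (targetDecomposition R ts)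
    filters []       = []
    filters (t ∷ ts) = ∩-upset-isFilter (detects-upward t) ∷ filters ts
    evaluates : ∀ ts y → T (R y) → + count (detects P y) ts ≡ evalDecomp P (targetDecomposition R ts) y
    evaluates []       y Ry = refl
    evaluates (t ∷ ts) y Ry rewrite to T-≡ Ry with detects P y t
    ... | true  = cong (λ v → + 1 * + 1 + v) (evaluates ts y Ry)
    ... | false = trans (evaluates ts y Ry) (sym (ℤ.+-identityˡ _))

  integralVia-targetDecomposition-cong : ∀ {R R′} ts →
    All (λ t → χ P (R ∩ detectors t) ≡ χ P (R′ ∩ detectors t)) ts →
    integralVia P (targetDecomposition R ts) ≡ integralVia P (targetDecomposition R′ ts)
  integralVia-targetDecomposition-cong []       []       = refl
  integralVia-targetDecomposition-cong (t ∷ ts) (e ∷ es) =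
    cong₂ _+_ (cong (λ v → + 1 * v) e) (integralVia-targetDecomposition-cong ts es)

count-≢0 : ∀ {A : Set} (p : A → Bool) {x xs} → x ∈ xs → T (p x) → count p xs ≢ 0
count-≢0 p {xs = a ∷ as} (here refl) px rewrite to T-≡ px = λ ()
count-≢0 p {xs = a ∷ as} (there x∈as) px with p a
... | true  = λ ()
... | false = count-≢0 p x∈as px

tildeModel-detected : ∀ N R {t y} → t ∈ targets N → T (detects (poset N) y t) → tildeModel N R y ≡ R y
tildeModel-detected N R {y = y} t∈T d with h N y | count-≢0 (detects (poset N) y) t∈T d
... | ℕ.zero  | h≢0 = contradiction refl h≢0
... | ℕ.suc _ | _   = refl

theorem4p11 : (N : SensorNetwork) (Pχ : Subset (poset N)) →
    IsChiMinimalModel (poset N) Pχ →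
    (ds₁ ds₂ : List (ℤ × Subset (poset N))) →
    IsFilterDecomposition (poset N) (tildeModel N Pχ) (λ x → + (h N x)) ds₁ →
    IsFilterDecomposition (poset N) (full (poset N)) (λ x → + (h N x)) ds₂ →
    integralVia (poset N) ds₁ ≡ integralVia (poset N) ds₂
theorem4p11 N Pχ (reduction , _) ds₁ ds₂ D₁ D₂ = begin
  integralVia P ds₁
    ≡⟨ integralVia-independent D₁ (targetDecomposition-isFilterDecomposition P̃χ ts) ⟩
  integralVia P (targetDecomposition P̃χ ts)
    ≡⟨ integralVia-targetDecomposition-cong ts (All.tabulate χ-agrees) ⟩
  integralVia P (targetDecomposition (full P) ts)
    ≡⟨ integralVia-independent (targetDecomposition-isFilterDecomposition (full P) ts) D₂ ⟩
  integralVia P ds₂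
    ∎
  where
  open ≡-Reasoning
  P = poset N
  open EulerCalculus P
  ts = targets N
  P̃χ = tildeModel N Pχ
  χ-agrees : ∀ {t} → t ∈ ts → χ P (P̃χ ∩ detectors t) ≡ χ P (full P ∩ detectors t)
  χ-agrees {t} t∈ts = trans (χ-cong λ y → ∧-cong-T (tildeModel-detected N Pχ t∈ts))
                        (sym (χ-∩-reduction reduction (detects-upward t)))
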